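{- Let $t\ge 1$. Any monomial whose support contains more than $t$ variables from a single row of the variable matrix survives $R_\epsilon$ with probability at most $1/n^{\epsilon\log t}$.
   Context: Let $n=2^k$, $\mathbb{F}_n=\mathbb{F}_{2^k}$ with elements identified with $[n]$; variables $x_{i,j}$, $i,j\in[n]$, arranged in an $n\times n$ variable matrix whose $i$-th row is $\{x_{i,j}:j\in[n]\}$. The support of a monomial is the set of variables with positive exponent; logarithms are base $2$. Fix an $\mathbb{F}_2$-linear isomorphism $\phi:\mathbb{F}_{2^k}\to\mathbb{F}_2^k$, $[a]=\phi(a)$; for $f=\sum_{i<d}a_iZ^i$, $[f]\in\mathbb{F}_2^{kd}$ concatenates $[a_0],\dots,[a_{d-1}]$. For $i\in\mathbb{F}_n$, $\mathsf{Eval}_i$ is the $dk\times k$ matrix with $[f(i)]=[f]\cdot\mathsf{Eval}_i$, and $\overline{\mathsf{Eval}_i}$ is the $dk\times 2^k$ matrix of all $\mathbb{F}_2$-linear combinations of columns of $\mathsf{Eval}_i$. Procedure $R_\epsilon$ ($\epsilon k$ an integer): start with empty matrix $\mathcal{M}$ and empty vector $\mathcal{B}$; for $i=1,\dots,n$, repeat $\epsilon k$ times: if all columns of $\overline{\mathsf{Eval}_i}$ lie in the column span of $\mathcal{M}$ do nothing, else pick a uniformly random column of $\overline{\mathsf{Eval}_i}$ outside that span and a uniformly random $b\in\mathbb{F}_2$ and append them to $\mathcal{M}$ and $\mathcal{B}$; then set $A_i=\{v\in\mathbb{F}_2^{kd}:v\mathcal{M}=\mathcal{B}\}$. Output $S_0=\{x_{i,j}:j\neq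 f(i)\ \forall f\text{ with }[f]\in A_n\}$. A monomial survives if none of its variables lies in $S_0$. -}

module Defs where

open import Data.Bool.ListAction using (any; all)
open import Data.Bool using (T?; Bool; true; false; _xor_; _∧_; _∨_; if_then_else_; not)
open import Data.Nat as ℕ using (ℕ; zero; suc; _^_)
open import Data.Fin as Fin using (Fin)
open import Data.Fin.Properties using () renaming (_≟_ to _≟ᶠ_)
open import Data.Vec as Vec using (Vec; []; _∷_)
open import Data.Vec.Properties using (≡-dec)
open import Data.Bool.Properties using () renaming (_≟_ to _≟ᵇ_)
open import Data.List as List using (List; []; _∷_; _++_)
open import Data.Product using (_×_; _,_; ∃; proj₁; proj₂)
open import Data.Integer using (+_)
open import Data.Rational as ℚ using (ℚ; 0ℚ; _/_)
open import Relation.Binary.PropositionalEquality using (_≡_; _≢_)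
open import Relation.Nullary.Decidable using (⌊_⌋)
open import Algebra.Structures using (IsCommutativeRing)

-- The field F_{2^k}, with its elements identified with [n] = Fin (2^k),
-- together with a fixed F_2-linear isomorphism φ : F_{2^k} → F_2^k
-- (F_2 = Bool, addition = xor, multiplication = ∧).

_⊕_ : ∀ {m} → Vec Bool m → Vec Bool m → Vec Bool m
_⊕_ = Vec.zipWith _xor_

record GF2^ (k : ℕ) : Set where
  field
    _+F_ _*F_ : Fin (2 ^ k) → Fin (2 ^ k) → Fin (2 ^ k)
    -F_       : Fin (2 ^ k) → Fin (2 ^ k)
    0F 1F     : Fin (2 ^ k)
    isCommRing : IsCommutativeRing _≡_ _+F_ _*F_ -F_ 0F 1F
    0≢1       : 0F ≢ 1F
    inverse   : ∀ a → a ≢ 0F → ∃ λ b → a *F b ≡ 1F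
    φ         : Fin (2 ^ k) → Vec Bool k
    ψ         : Vec Bool k → Fin (2 ^ k)
    φψ        : ∀ v → φ (ψ v) ≡ v
    ψφ        : ∀ a → ψ (φ a) ≡ a
    φ-additive : ∀ a b → φ (a +F b) ≡ φ a ⊕ φ b

allVecs : ∀ {A : Set} → List A → (m : ℕ) → List (Vec A m)
allVecs xs zero    = [] ∷ []
allVecs xs (suc m) = List.concatMap (λ x → List.map (x ∷_) (allVecs xs m)) xs

dot : ∀ {m} → Vec Bool m → Vec Bool m → Bool
dot u v = Vec.foldr _ _xor_ false (Vec.zipWith _∧_ u v)

zeros : ∀ {m} → Vec Bool m
zeros = Vec.replicate _ false

combos : ∀ {m} → List (Vec Bool m) → List (Vec Bool m)
combos []       = zeros ∷ []
combos (c ∷ cs) = combos cs ++ List.map (c ⊕_) (combos cs)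

inSpan : ∀ {m} → Vec Bool m → List (Vec Bool m) → Bool
inSpan v cs = any (λ w → ⌊ ≡-dec _≟ᵇ_ v w ⌋) (combos cs)

unit : ∀ {k} → Fin k → Vec Bool k
unit r = Vec.tabulate (λ s → ⌊ r ≟ᶠ s ⌋)

-- mean of a list of rationals (0 for the empty list, never used)
mean : List ℚ → ℚ
mean []       = 0ℚ
mean (x ∷ xs) = List.foldr ℚ._+_ 0ℚ (x ∷ xs) ℚ.* (+ 1 / suc (List.length xs))

-- The procedure R_ε, for polynomials of degree < d, with m = εk repetitions.

module Procedure {k : ℕ} (F : GF2^ k) (d : ℕ) where
  open GF2^ F

  n : ℕ
  n = 2 ^ k

  elems : List (Fin n)
  elems = List.allFin n

  pow : Fin n → ℕ → Fin n
  pow a zero    = 1F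
  pow a (suc l) = a *F pow a l

  evalPoly : Vec (Fin n) d → Fin n → Fin n
  evalPoly as x = Vec.foldr _ _+F_ 0F
                    (Vec.zipWith (λ a l → a *F pow x (Fin.toℕ l)) as (Vec.allFin d))

  encode : Vec (Fin n) d → Vec Bool (d ℕ.* k)
  encode as = Vec.concat (Vec.map φ as)

  -- Eval_i : dk × k matrix, entry at row (l , r), column c is
  -- φ(ψ(e_r) · i^l)_c, so that [f(i)] = [f] · Eval_i.
  Eval : Fin n → Vec (Vec Bool k) (d ℕ.* k)   -- list of rows
  Eval i = Vec.concat (Vec.tabulate λ (l : Fin d) →
             Vec.tabulate λ (r : Fin k) → φ (ψ (unit r) *F pow i (Fin.toℕ l)))

  -- the column of \overline{Eval_i} indexed by u ∈ F_2^k: Eval_i · u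
  -- (the F_2-linear combination of the columns of Eval_i with coefficients u)
  evalCol : Fin n → Vec Bool k → Vec Bool (d ℕ.* k)
  evalCol i u = Vec.map (λ row → dot row u) (Eval i)

  -- state: the columns of 𝓜 paired with the corresponding entries of 𝓑
  State : Set
  State = List (Vec Bool (d ℕ.* k) × Bool)

  -- v ∈ A  iff  v 𝓜 = 𝓑
  satisfies : State → Vec Bool (d ℕ.* k) → Bool
  satisfies s v = all (λ { (c , b) → ⌊ dot v c ≟ᵇ b ⌋ }) s

  -- one inner iteration for row i, followed by the continuation `cont`;
  -- returns the expectation of `cont` applied to the resulting state.
  step : Fin n → State → (State → ℚ) → ℚ
  step i s cont with List.filter (λ u → T? (not (inSpan (evalCol i u) (List.map proj₁ s))))
                                  (allVecs (false ∷ true ∷ []) k)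
  ... | []    = cont s
  ... | cands = mean (List.concatMap
                  (λ u → List.map (λ b → cont (s ++ (evalCol i u , b) ∷ [])) (false ∷ true ∷ []))
                  cands)

  runSteps : List (Fin n) → State → (State → ℚ) → ℚ
  runSteps []       s g = g s
  runSteps (i ∷ is) s g = step i s (λ s' → runSteps is s' g)

  schedule : ℕ → List (Fin n)
  schedule m = List.concatMap (List.replicate m) elems

  -- x_{i,j} ∉ S_0  iff  j = f(i) for some f with [f] ∈ A_n
  notInS0 : State → Fin n → Fin n → Bool
  notInS0 s i j = any (λ as → satisfies s (encode as) ∧ ⌊ j ≟ᶠ evalPoly as i ⌋)
                           (allVecs elems d)

  -- a monomial Π x_{i,j}^{e i j} survives iff no variable of its support is in S_0
  survives : (Fin n → Fin n → ℕ) → State → Bool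
  survives e s = all (λ i → all (λ j →
                   ⌊ e i j ℕ.≟ 0 ⌋ ∨ notInS0 s i j) elems) elems

  survivalProb : ℕ → (Fin n → Fin n → ℕ) → ℚ
  survivalProb m e = runSteps (schedule m) []
                       (λ s → if survives e s then ℚ.1ℚ else 0ℚ)

  rowSupport : (Fin n → Fin n → ℕ) → Fin n → ℕ
  rowSupport e i = List.length (List.filter (λ j → ℕ._<?_ 0 (e i j)) elems)

-- Fix a row i₀ whose support S has more than t variables, and call a state alive when every j ∈ S
-- is still f(i₀) for some f consistent with the constraints collected so far; a surviving monomial
-- ends in an alive state.  Since [f]·Eval_{i₀}·u = ⟨[f(i₀)], u⟩, a column Eval_{i₀}·u in the span
-- of the constraints fixes ⟨[j], u⟩ for all j ∈ S, so the vectors [j] must agree on u; and after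
-- appending a fresh column (Eval_{i₀}·u, b) the row stays alive only if they agree on u and b is
-- their common value.  By Parseval at most 2^k/|S| vectors u make the [j] agree, so at most a 1/t
-- fraction of the fresh choices (u, b) keeps the row alive.  Hence each of the m = εk iterations at
-- row i₀ multiplies the bound on the survival probability by 1/t, the other iterations do not
-- increase it, and t^m = n^(ε log t).

module Submission where

open import Defs
open import Algebra.Bundles using (CommutativeRing)
open import Algebra.Structures using (IsCommutativeRing)
import Algebra.Properties.CommutativeSemigroup as CommutativeSemigroupProperties
open import Data.Bool using (Bool; true; false; not; T; T?; if_then_else_; _xor_; _∧_)
open import Data.Bool.ListAction using (all)
import Data.Bool.Properties as Boolₚ
open import Data.Empty using (⊥; ⊥-elim)
open import Data.Fin as Fin using (Fin)
import Data.Fin.Properties as Finₚ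
open import Data.Integer as ℤ using (ℤ; +_; 0ℤ; 1ℤ; -1ℤ; +≤+)
import Data.Integer.Properties as ℤₚ
open import Data.Integer.Tactic.RingSolver using (solve-∀)
open import Data.List as List using (List; []; _∷_; _++_; length)
import Data.List.Properties as Listₚ
open import Data.List.Membership.Propositional using (_∈_)
open import Data.List.Membership.Propositional.Properties using (∈-++⁻; ∈-map⁻; ∈-filter⁻; ∈-allFin)
open import Data.List.Relation.Unary.All as All using (All; []; _∷_)
open import Data.List.Relation.Unary.All.Properties using (all⁺; all⁻; map⁺; ++⁻ʳ)
open import Data.List.Relation.Unary.AllPairs using ([]; _∷_)
open import Data.List.Relation.Unary.Any as Any using (here; there)
open import Data.List.Relation.Unary.Any.Properties using (any⁺; any⁻)
open import Data.List.Relation.Unary.Unique.Propositional using (Unique)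
import Data.List.Relation.Unary.Unique.Propositional.Properties as Uniqueₚ
open import Data.Nat as ℕ using (ℕ; zero; suc; _^_; _≥_; _<_)
import Data.Nat.Properties as ℕₚ
open import Data.Nat.Coprimality as Coprimality using (1-coprimeTo)
open import Data.Product using (∃; _×_; _,_; proj₁; proj₂)
import Data.Rational as ℚ
import Data.Rational.Properties as ℚₚ
import Data.Rational.Unnormalised as ℚᵘ
import Data.Rational.Unnormalised.Properties as ℚᵘₚ
open import Data.Sum using (inj₁; inj₂)
open import Data.Vec as Vec using (Vec; []; _∷_)
open import Data.Vec.Properties as Vecₚ using (≡-dec)
open import Function using (_∘_; id)
open import Function.Bundles using (Equivalence)
open import Relation.Binary.PropositionalEquality
open import Relation.Nullary using (¬_; Dec; yes; no)
open import Relation.Nullary.Decidable using (⌊_⌋; ⌊⌋-map′; toWitness; fromWitness)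

private variable A B : Set

T-∧⁻ : ∀ {a b} → T (a ∧ b) → T a × T b
T-∧⁻ {a} = Equivalence.to (Boolₚ.T-∧ {a})

T-∧⁺ : ∀ {a b} → T a → T b → T (a ∧ b)
T-∧⁺ ta tb = Equivalence.from Boolₚ.T-∧ (ta , tb)

count : (A → Bool) → List A → ℕ
count p []       = 0
count p (x ∷ xs) = if p x then suc (count p xs) else count p xs

count-mono : ∀ (p q : A → Bool) → (∀ x → T (p x) → T (q x)) → ∀ xs → count p xs ℕ.≤ count q xs
count-mono p q p⇒q []       = ℕ.z≤n
count-mono p q p⇒q (x ∷ xs) with p x in px | q x in qx
... | true  | true  = ℕ.s≤s (count-mono p q p⇒q xs)
... | true  | false = ⊥-elim (subst T qx (p⇒q x (subst T (sym px) _)))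
... | false | true  = ℕₚ.m≤n⇒m≤1+n (count-mono p q p⇒q xs)
... | false | false = count-mono p q p⇒q xs

count-accept : ∀ (p : A → Bool) {x} xs → T (p x) → count p (x ∷ xs) ≡ suc (count p xs)
count-accept p {x} xs px with p x
... | true = refl

count-reject : ∀ (p : A → Bool) {x} xs → ¬ T (p x) → count p (x ∷ xs) ≡ count p xs
count-reject p {x} xs ¬px with p x
... | true  = ⊥-elim (¬px _)
... | false = refl

count-filter : ∀ (p q : A → Bool) xs → count p (List.filter (T? ∘ q) xs) ℕ.≤ count p xs
count-filter p q []       = ℕ.z≤n
count-filter p q (x ∷ xs) with q x
... | true  with p x
...   | true  = ℕ.s≤s (count-filter p q xs)
...   | false = count-filter p q xs
count-filter p q (x ∷ xs) | false with p x
...   | true  = ℕₚ.m≤n⇒m≤1+n (count-filter p q xs)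
...   | false = count-filter p q xs

length-filter-not+count : ∀ (q : A → Bool) xs → length (List.filter (T? ∘ not ∘ q) xs) ℕ.+ count q xs ≡ length xs
length-filter-not+count q []       = refl
length-filter-not+count q (x ∷ xs) with q x
... | true  = trans (ℕₚ.+-suc _ _) (cong suc (length-filter-not+count q xs))
... | false = cong suc (length-filter-not+count q xs)

nonempty⇒∈ : ∀ {xs : List A} → 0 < length xs → ∃ λ x → x ∈ xs
nonempty⇒∈ {xs = x ∷ _} _ = x , here refl

xor-interchange : ∀ a b c d → (a xor b) xor (c xor d) ≡ (a xor c) xor (b xor d)
xor-interchange = CommutativeSemigroupProperties.interchange
  (CommutativeRing.+-commutativeSemigroup Boolₚ.xor-∧-commutativeRing)

⊕-assoc : ∀ {m} (x y z : Vec Bool m) → (x ⊕ y) ⊕ z ≡ x ⊕ (y ⊕ z)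
⊕-assoc = Vecₚ.zipWith-assoc Boolₚ.xor-assoc

⊕-identityˡ : ∀ {m} (x : Vec Bool m) → zeros ⊕ x ≡ x
⊕-identityˡ = Vecₚ.zipWith-identityˡ Boolₚ.xor-identityˡ

⊕-identityʳ : ∀ {m} (x : Vec Bool m) → x ⊕ zeros ≡ x
⊕-identityʳ = Vecₚ.zipWith-identityʳ Boolₚ.xor-identityʳ

⊕-self : ∀ {m} (x : Vec Bool m) → x ⊕ x ≡ zeros
⊕-self []      = refl
⊕-self (a ∷ x) = cong₂ _∷_ (Boolₚ.xor-same a) (⊕-self x)

⊕≡zeros⇒≡ : ∀ {m} {x y : Vec Bool m} → x ⊕ y ≡ zeros → x ≡ y
⊕≡zeros⇒≡ {x = x} {y} x⊕y≡0 = begin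
  x            ≡⟨ sym (⊕-identityʳ x) ⟩
  x ⊕ zeros    ≡⟨ cong (x ⊕_) (sym (⊕-self y)) ⟩
  x ⊕ (y ⊕ y)  ≡⟨ sym (⊕-assoc x y y) ⟩
  (x ⊕ y) ⊕ y  ≡⟨ cong (_⊕ y) x⊕y≡0 ⟩
  zeros ⊕ y    ≡⟨ ⊕-identityˡ y ⟩
  y            ∎
  where open ≡-Reasoning

dot-comm : ∀ {m} (u v : Vec Bool m) → dot u v ≡ dot v u
dot-comm []      []      = refl
dot-comm (a ∷ u) (b ∷ v) = cong₂ _xor_ (Boolₚ.∧-comm a b) (dot-comm u v)

dot-zerosˡ : ∀ {m} (v : Vec Bool m) → dot zeros v ≡ false
dot-zerosˡ []      = refl
dot-zerosˡ (_ ∷ v) = dot-zerosˡ v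

dot-zerosʳ : ∀ {m} (v : Vec Bool m) → dot v zeros ≡ false
dot-zerosʳ v = trans (dot-comm v zeros) (dot-zerosˡ v)

dot-⊕ˡ : ∀ {m} (x y v : Vec Bool m) → dot (x ⊕ y) v ≡ dot x v xor dot y v
dot-⊕ˡ []      []      []      = refl
dot-⊕ˡ (a ∷ x) (b ∷ y) (c ∷ v) =
  trans (cong₂ _xor_ (Boolₚ.∧-distribʳ-xor c a b) (dot-⊕ˡ x y v))
        (xor-interchange (a ∧ c) (b ∧ c) (dot x v) (dot y v))

dot-⊕ʳ : ∀ {m} (v x y : Vec Bool m) → dot v (x ⊕ y) ≡ dot v x xor dot v y
dot-⊕ʳ v x y = begin
  dot v (x ⊕ y)        ≡⟨ dot-comm v (x ⊕ y) ⟩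
  dot (x ⊕ y) v        ≡⟨ dot-⊕ˡ x y v ⟩
  dot x v xor dot y v  ≡⟨ cong₂ _xor_ (dot-comm x v) (dot-comm y v) ⟩
  dot v x xor dot v y  ∎
  where open ≡-Reasoning

dot-++ : ∀ {m p} (x : Vec Bool m) (x′ : Vec Bool p) y y′ →
         dot (x Vec.++ x′) (y Vec.++ y′) ≡ dot x y xor dot x′ y′
dot-++ []      x′ []      y′ = refl
dot-++ (a ∷ x) x′ (b ∷ y) y′ =
  trans (cong ((a ∧ b) xor_) (dot-++ x x′ y y′))
        (sym (Boolₚ.xor-assoc (a ∧ b) (dot x y) (dot x′ y′)))

IsAdditive : ∀ {m} → (Vec Bool m → Bool) → Set
IsAdditive h = ∀ x y → h (x ⊕ y) ≡ h x xor h y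

additive-zeros : ∀ {m} (h : Vec Bool m → Bool) → IsAdditive h → h zeros ≡ false
additive-zeros h additive = begin
  h zeros              ≡⟨ cong h (sym (⊕-self zeros)) ⟩
  h (zeros ⊕ zeros)    ≡⟨ additive zeros zeros ⟩
  h zeros xor h zeros  ≡⟨ Boolₚ.xor-same (h zeros) ⟩
  false                ∎
  where open ≡-Reasoning

unit-suc : ∀ {m} (r : Fin m) → unit {suc m} (Fin.suc r) ≡ false ∷ unit r
unit-suc r = cong (false ∷_) (Vecₚ.tabulate-cong λ s → ⌊⌋-map′ (cong Fin.suc) Finₚ.suc-injective (r Finₚ.≟ s))

unit-zero : ∀ {m} → unit {suc m} Fin.zero ≡ true ∷ zeros
unit-zero {m} = cong (true ∷_) (tabulate-false m)
  where
  tabulate-false : ∀ m → Vec.tabulate {n = m} (λ _ → false) ≡ zeros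
  tabulate-false zero    = refl
  tabulate-false (suc m) = cong (false ∷_) (tabulate-false m)

additive⇒dot : ∀ {m} (h : Vec Bool m → Bool) → IsAdditive h →
               ∀ x → h x ≡ dot x (Vec.tabulate (h ∘ unit))
additive⇒dot {zero}  h additive [] = additive-zeros h additive
additive⇒dot {suc m} h additive (b ∷ x) = begin
  h (b ∷ x)                      ≡⟨ cong h (cong₂ _∷_ (sym (Boolₚ.xor-identityʳ b)) (sym (⊕-identityˡ x))) ⟩
  h ((b ∷ zeros) ⊕ (false ∷ x))  ≡⟨ additive (b ∷ zeros) (false ∷ x) ⟩
  h (b ∷ zeros) xor h′ x         ≡⟨ cong₂ _xor_ (h-head b) (additive⇒dot h′ h′-additive x) ⟩
  (b ∧ h (unit Fin.zero)) xor dot x (Vec.tabulate (h′ ∘ unit))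
    ≡⟨ cong (λ c → (b ∧ h (unit Fin.zero)) xor dot x c) (Vecₚ.tabulate-cong (cong h ∘ sym ∘ unit-suc)) ⟩
  dot (b ∷ x) (Vec.tabulate (h ∘ unit))  ∎
  where
  open ≡-Reasoning
  h′ : Vec Bool m → Bool
  h′ y = h (false ∷ y)
  h′-additive : IsAdditive h′
  h′-additive y z = additive (false ∷ y) (false ∷ z)
  h-head : ∀ b → h (b ∷ zeros) ≡ b ∧ h (unit Fin.zero)
  h-head false = additive-zeros h additive
  h-head true  = cong h (sym unit-zero)

inSpan⇒∈combos : ∀ {m} (v : Vec Bool m) cs → T (inSpan v cs) → v ∈ combos cs
inSpan⇒∈combos v cs = Any.map toWitness ∘ any⁻ (λ w → ⌊ ≡-dec Boolₚ._≟_ v w ⌋) (combos cs)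

module _ where
  open import Data.Integer using (_+_; _*_; -_)

  ∑ : List A → (A → ℤ) → ℤ
  ∑ []       f = 0ℤ
  ∑ (x ∷ xs) f = f x + ∑ xs f

  syntax ∑ xs (λ x → e) = ∑[ x ← xs ] e

  ∑-cong : ∀ (xs : List A) {f g : A → ℤ} → (∀ x → x ∈ xs → f x ≡ g x) → ∑ xs f ≡ ∑ xs g
  ∑-cong []       f≗g = refl
  ∑-cong (x ∷ xs) f≗g = cong₂ _+_ (f≗g x (here refl)) (∑-cong xs (λ y → f≗g y ∘ there))

  ∑-++ : ∀ (xs ys : List A) f → ∑ (xs ++ ys) f ≡ ∑ xs f + ∑ ys f
  ∑-++ []       ys f = sym (ℤₚ.+-identityˡ (∑ ys f))
  ∑-++ (x ∷ xs) ys f = trans (cong (_+_ (f x)) (∑-++ xs ys f)) (sym (ℤₚ.+-assoc (f x) _ _))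

  ∑-map : ∀ (g : B → A) (xs : List B) f → ∑ (List.map g xs) f ≡ ∑ xs (f ∘ g)
  ∑-map g []       f = refl
  ∑-map g (x ∷ xs) f = cong (_+_ (f (g x))) (∑-map g xs f)

  ∑-const : ∀ (xs : List A) c → ∑[ _ ← xs ] c ≡ + length xs * c
  ∑-const []       c = sym (ℤₚ.*-zeroˡ c)
  ∑-const (x ∷ xs) c = begin
    c + ∑[ _ ← xs ] c         ≡⟨ cong (_+_ c) (∑-const xs c) ⟩
    c + + length xs * c       ≡⟨ cong (_+ + length xs * c) (sym (ℤₚ.*-identityˡ c)) ⟩
    1ℤ * c + + length xs * c  ≡⟨ sym (ℤₚ.*-distribʳ-+ c 1ℤ (+ length xs)) ⟩
    + suc (length xs) * c     ∎
    where open ≡-Reasoning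

  ∑-+ : ∀ (xs : List A) f g → ∑[ x ← xs ] (f x + g x) ≡ ∑ xs f + ∑ xs g
  ∑-+ []       f g = refl
  ∑-+ (x ∷ xs) f g = trans (cong (_+_ (f x + g x)) (∑-+ xs f g))
    (CommutativeSemigroupProperties.interchange ℤₚ.+-commutativeSemigroup (f x) (g x) _ _)

  ∑-*ˡ : ∀ (xs : List A) c f → ∑[ x ← xs ] (c * f x) ≡ c * ∑ xs f
  ∑-*ˡ []       c f = sym (ℤₚ.*-zeroʳ c)
  ∑-*ˡ (x ∷ xs) c f = trans (cong (_+_ (c * f x)) (∑-*ˡ xs c f)) (sym (ℤₚ.*-distribˡ-+ c (f x) _))

  ∑-*ʳ : ∀ (xs : List A) c f → ∑[ x ← xs ] (f x * c) ≡ ∑ xs f * c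
  ∑-*ʳ xs c f = begin
    ∑[ x ← xs ] (f x * c)  ≡⟨ ∑-cong xs (λ x _ → ℤₚ.*-comm (f x) c) ⟩
    ∑[ x ← xs ] (c * f x)  ≡⟨ ∑-*ˡ xs c f ⟩
    c * ∑ xs f             ≡⟨ ℤₚ.*-comm c (∑ xs f) ⟩
    ∑ xs f * c             ∎
    where open ≡-Reasoning

  ∑-swap : ∀ (xs : List A) (ys : List B) (f : A → B → ℤ) →
           ∑[ x ← xs ] ∑[ y ← ys ] f x y ≡ ∑[ y ← ys ] ∑[ x ← xs ] f x y
  ∑-swap []       ys f = trans (sym (ℤₚ.*-zeroʳ (+ length ys))) (sym (∑-const ys 0ℤ))
  ∑-swap (x ∷ xs) ys f = trans (cong (_+_ (∑ ys (f x))) (∑-swap xs ys f))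
                               (sym (∑-+ ys (f x) (λ y → ∑[ x ← xs ] f x y)))

  ∑-*-∑ : ∀ (xs ys : List A) (f g : A → ℤ) →
          ∑ xs f * ∑ ys g ≡ ∑[ x ← xs ] ∑[ y ← ys ] (f x * g y)
  ∑-*-∑ xs ys f g = begin
    ∑ xs f * ∑ ys g                      ≡⟨ sym (∑-*ʳ xs (∑ ys g) f) ⟩
    ∑[ x ← xs ] (f x * ∑ ys g)           ≡⟨ ∑-cong xs (λ x _ → sym (∑-*ˡ ys (f x) g)) ⟩
    ∑[ x ← xs ] ∑[ y ← ys ] (f x * g y)  ∎
    where open ≡-Reasoning

  χ : Bool → ℤ
  χ false = 1ℤ
  χ true  = -1ℤ

  χ-xor : ∀ a b → χ (a xor b) ≡ χ a * χ b
  χ-xor false false = refl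
  χ-xor false true  = refl
  χ-xor true  false = refl
  χ-xor true  true  = refl

  χ-square : ∀ a → χ a * χ a ≡ 1ℤ
  χ-square false = refl
  χ-square true  = refl

  allBoolVecs : (m : ℕ) → List (Vec Bool m)
  allBoolVecs = allVecs (false ∷ true ∷ [])

  length-allBoolVecs : ∀ m → length (allBoolVecs m) ≡ 2 ^ m
  length-allBoolVecs zero    = refl
  length-allBoolVecs (suc m) = begin
    length (List.map (false ∷_) V ++ List.map (true ∷_) V ++ [])
      ≡⟨ Listₚ.length-++ (List.map (false ∷_) V) ⟩
    length (List.map (false ∷_) V) ℕ.+ length (List.map (true ∷_) V ++ [])
      ≡⟨ cong₂ ℕ._+_ (Listₚ.length-map (false ∷_) V)
                     (trans (Listₚ.length-++ (List.map (true ∷_) V)) (ℕₚ.+-identityʳ _)) ⟩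
    length V ℕ.+ length (List.map (true ∷_) V)
      ≡⟨ cong₂ ℕ._+_ (length-allBoolVecs m) (trans (Listₚ.length-map (true ∷_) V) (length-allBoolVecs m)) ⟩
    2 ^ m ℕ.+ (2 ^ m)
      ≡⟨ cong (2 ^ m ℕ.+_) (sym (ℕₚ.+-identityʳ (2 ^ m))) ⟩
    2 ^ suc m ∎
    where
    open ≡-Reasoning
    V = allBoolVecs m

  ∑-allBoolVecs-suc : ∀ m (f : Vec Bool (suc m) → ℤ) →
    ∑ (allBoolVecs (suc m)) f ≡ ∑[ u ← allBoolVecs m ] f (false ∷ u) + ∑[ u ← allBoolVecs m ] f (true ∷ u)
  ∑-allBoolVecs-suc m f = begin
    ∑ (List.map (false ∷_) V ++ List.map (true ∷_) V ++ []) f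
      ≡⟨ ∑-++ (List.map (false ∷_) V) _ f ⟩
    ∑ (List.map (false ∷_) V) f + ∑ (List.map (true ∷_) V ++ []) f
      ≡⟨ cong₂ _+_ (∑-map (false ∷_) V f)
                   (trans (cong (λ vs → ∑ vs f) (Listₚ.++-identityʳ (List.map (true ∷_) V))) (∑-map (true ∷_) V f)) ⟩
    ∑[ u ← V ] f (false ∷ u) + ∑[ u ← V ] f (true ∷ u) ∎
    where
    open ≡-Reasoning
    V = allBoolVecs m

  characterSum-zeros : ∀ m → ∑[ u ← allBoolVecs m ] χ (dot zeros u) ≡ + (2 ^ m)
  characterSum-zeros m = begin
    ∑[ u ← allBoolVecs m ] χ (dot zeros u)  ≡⟨ ∑-cong (allBoolVecs m) (λ u _ → cong χ (dot-zerosˡ u)) ⟩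
    ∑[ u ← allBoolVecs m ] 1ℤ               ≡⟨ ∑-const (allBoolVecs m) 1ℤ ⟩
    + length (allBoolVecs m) * 1ℤ           ≡⟨ ℤₚ.*-identityʳ _ ⟩
    + length (allBoolVecs m)                ≡⟨ cong +_ (length-allBoolVecs m) ⟩
    + (2 ^ m)                               ∎
    where open ≡-Reasoning

  characterSum-nonzero : ∀ m (x : Vec Bool m) → x ≢ zeros → ∑[ u ← allBoolVecs m ] χ (dot x u) ≡ 0ℤ
  characterSum-nonzero zero    []           x≢0 = ⊥-elim (x≢0 refl)
  characterSum-nonzero (suc m) (false ∷ x)  x≢0 = begin
    ∑[ u ← allBoolVecs (suc m) ] χ (dot (false ∷ x) u)  ≡⟨ ∑-allBoolVecs-suc m _ ⟩
    Σx + Σx                                             ≡⟨ cong₂ _+_ Σx≡0 Σx≡0 ⟩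
    0ℤ                                                  ∎
    where
    open ≡-Reasoning
    Σx   = ∑[ u ← allBoolVecs m ] χ (dot x u)
    Σx≡0 = characterSum-nonzero m x (x≢0 ∘ cong (false ∷_))
  characterSum-nonzero (suc m) (true ∷ x) _ = begin
    ∑[ u ← allBoolVecs (suc m) ] χ (dot (true ∷ x) u)  ≡⟨ ∑-allBoolVecs-suc m _ ⟩
    Σx + ∑[ u ← V ] χ (true xor dot x u)               ≡⟨ cong (_+_ Σx) (∑-cong V (λ u _ → χ-xor true (dot x u))) ⟩
    Σx + ∑[ u ← V ] (-1ℤ * χ (dot x u))                ≡⟨ cong (_+_ Σx) (∑-*ˡ V -1ℤ (λ u → χ (dot x u))) ⟩
    Σx + -1ℤ * Σx                                      ≡⟨ cong (_+_ Σx) (ℤₚ.-1*i≡-i Σx) ⟩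
    Σx + - Σx                                          ≡⟨ ℤₚ.+-inverseʳ Σx ⟩
    0ℤ                                                 ∎
    where
    open ≡-Reasoning
    V  = allBoolVecs m
    Σx = ∑[ u ← V ] χ (dot x u)

  characterSum-⊕ : ∀ m (x y : Vec Bool m) → x ≢ y → ∑[ u ← allBoolVecs m ] χ (dot (x ⊕ y) u) ≡ 0ℤ
  characterSum-⊕ m x y x≢y = characterSum-nonzero m (x ⊕ y) (x≢y ∘ ⊕≡zeros⇒≡)

  characterSum-⊕-self : ∀ m (x : Vec Bool m) → ∑[ u ← allBoolVecs m ] χ (dot (x ⊕ x) u) ≡ + (2 ^ m)
  characterSum-⊕-self m x =
    trans (∑-cong (allBoolVecs m) (λ u _ → cong (λ z → χ (dot z u)) (⊕-self x))) (characterSum-zeros m)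

  orthogonality : ∀ m (x : Vec Bool m) {ys} → Unique ys → x ∈ ys →
                  ∑[ y ← ys ] ∑[ u ← allBoolVecs m ] χ (dot (x ⊕ y) u) ≡ + (2 ^ m)
  orthogonality m x {_ ∷ ys} (x∉ys ∷ _) (here refl) = begin
    ∑[ u ← allBoolVecs m ] χ (dot (x ⊕ x) u) + ∑[ y ← ys ] ∑[ u ← allBoolVecs m ] χ (dot (x ⊕ y) u)
      ≡⟨ cong₂ _+_ (characterSum-⊕-self m x) (∑-cong ys (λ y y∈ → characterSum-⊕ m x y (All.lookup x∉ys y∈))) ⟩
    + (2 ^ m) + ∑[ _ ← ys ] 0ℤ
      ≡⟨ cong (_+_ (+ (2 ^ m))) (trans (∑-const ys 0ℤ) (ℤₚ.*-zeroʳ (+ length ys))) ⟩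
    + (2 ^ m) + 0ℤ
      ≡⟨ ℤₚ.+-identityʳ _ ⟩
    + (2 ^ m) ∎
    where open ≡-Reasoning
  orthogonality m x (y∉ys ∷ unique) (there x∈ys) = trans
    (cong₂ _+_ (characterSum-⊕ m x _ (λ { refl → All.lookup y∉ys x∈ys refl })) (orthogonality m x unique x∈ys))
    (ℤₚ.+-identityˡ _)

  walsh : ∀ {m} → List (Vec Bool m) → Vec Bool m → ℤ
  walsh xs u = ∑[ x ← xs ] χ (dot x u)

  parseval : ∀ m {xs : List (Vec Bool m)} → Unique xs →
             ∑[ u ← allBoolVecs m ] (walsh xs u * walsh xs u) ≡ + length xs * + (2 ^ m)
  parseval m {xs} unique = begin
    ∑[ u ← V ] (walsh xs u * walsh xs u)
      ≡⟨ ∑-cong V (λ u _ → ∑-*-∑ xs xs (λ x → χ (dot x u)) (λ y → χ (dot y u))) ⟩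
    ∑[ u ← V ] ∑[ x ← xs ] ∑[ y ← xs ] (χ (dot x u) * χ (dot y u))
      ≡⟨ ∑-cong V (λ u _ → ∑-cong xs (λ x _ → ∑-cong xs (λ y _ → χχ≡χ⊕ x y u))) ⟩
    ∑[ u ← V ] ∑[ x ← xs ] ∑[ y ← xs ] χ (dot (x ⊕ y) u)
      ≡⟨ ∑-swap V xs _ ⟩
    ∑[ x ← xs ] ∑[ u ← V ] ∑[ y ← xs ] χ (dot (x ⊕ y) u)
      ≡⟨ ∑-cong xs (λ x _ → ∑-swap V xs _) ⟩
    ∑[ x ← xs ] ∑[ y ← xs ] ∑[ u ← V ] χ (dot (x ⊕ y) u)
      ≡⟨ ∑-cong xs (λ x x∈xs → orthogonality m x unique x∈xs) ⟩
    ∑[ _ ← xs ] (+ (2 ^ m))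
      ≡⟨ ∑-const xs (+ (2 ^ m)) ⟩
    + length xs * + (2 ^ m) ∎
    where
    open ≡-Reasoning
    V = allBoolVecs m
    χχ≡χ⊕ : ∀ x y u → χ (dot x u) * χ (dot y u) ≡ χ (dot (x ⊕ y) u)
    χχ≡χ⊕ x y u = trans (sym (χ-xor (dot x u) (dot y u))) (cong χ (sym (dot-⊕ˡ x y u)))

  agreesWith : ∀ {m} → List (Vec Bool m) → Vec Bool m → Vec Bool m → Bool
  agreesWith xs x₀ u = all (λ x → ⌊ dot x u Boolₚ.≟ dot x₀ u ⌋) xs

  walsh-agreesWith : ∀ {m} xs (x₀ u : Vec Bool m) → T (agreesWith xs x₀ u) →
                     walsh xs u ≡ + length xs * χ (dot x₀ u)
  walsh-agreesWith xs x₀ u agrees = trans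
    (∑-cong xs (λ x x∈xs → cong χ (toWitness (All.lookup (all⁺ _ xs agrees) x∈xs))))
    (∑-const xs (χ (dot x₀ u)))

  walsh²-agreesWith : ∀ {m} xs (x₀ u : Vec Bool m) → T (agreesWith xs x₀ u) →
                      walsh xs u * walsh xs u ≡ + length xs * + length xs
  walsh²-agreesWith xs x₀ u agrees = begin
    walsh xs u * walsh xs u  ≡⟨ cong₂ _*_ (walsh-agreesWith xs x₀ u agrees) (walsh-agreesWith xs x₀ u agrees) ⟩
    (L * c) * (L * c)        ≡⟨ rearrange L c ⟩
    (L * L) * (c * c)        ≡⟨ cong (_*_ (L * L)) (χ-square (dot x₀ u)) ⟩
    (L * L) * 1ℤ             ≡⟨ ℤₚ.*-identityʳ (L * L) ⟩
    L * L                    ∎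
    where
    open ≡-Reasoning
    L = + length xs
    c = χ (dot x₀ u)
    rearrange : ∀ a b → (a * b) * (a * b) ≡ (a * a) * (b * b)
    rearrange = solve-∀

  square-nonneg : ∀ i → 0ℤ ℤ.≤ i * i
  square-nonneg (+ zero)  = +≤+ ℕ.z≤n
  square-nonneg (+ suc n) = +≤+ ℕ.z≤n
  square-nonneg ℤ.-[1+ n ] = +≤+ ℕ.z≤n

  count*≤∑ : ∀ (p : A → Bool) (f : A → ℤ) c xs → (∀ x → 0ℤ ℤ.≤ f x) → (∀ x → T (p x) → c ℤ.≤ f x) →
             + count p xs * c ℤ.≤ ∑ xs f
  count*≤∑ p f c []       f≥0 p⇒c≤f = ℤₚ.≤-refl
  count*≤∑ p f c (x ∷ xs) f≥0 p⇒c≤f with p x in px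
  ... | true  = begin
    + suc (count p xs) * c     ≡⟨ ℤₚ.*-distribʳ-+ c 1ℤ (+ count p xs) ⟩
    1ℤ * c + + count p xs * c  ≡⟨ cong (λ z → z + + count p xs * c) (ℤₚ.*-identityˡ c) ⟩
    c + + count p xs * c       ≤⟨ ℤₚ.+-mono-≤ (p⇒c≤f x (subst T (sym px) _)) (count*≤∑ p f c xs f≥0 p⇒c≤f) ⟩
    f x + ∑ xs f               ∎
    where open ℤₚ.≤-Reasoning
  ... | false = begin
    + count p xs * c       ≡⟨ sym (ℤₚ.+-identityˡ _) ⟩
    0ℤ + + count p xs * c  ≤⟨ ℤₚ.+-mono-≤ (f≥0 x) (count*≤∑ p f c xs f≥0 p⇒c≤f) ⟩
    f x + ∑ xs f           ∎
    where open ℤₚ.≤-Reasoning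

  count-agreesWith*length≤2^m : ∀ m {xs : List (Vec Bool m)} (x₀ : Vec Bool m) → Unique xs → 0 ℕ.< length xs →
                         count (agreesWith xs x₀) (allBoolVecs m) ℕ.* length xs ℕ.≤ 2 ^ m
  count-agreesWith*length≤2^m m {xs} x₀ unique xs≢[] =
    ℕₚ.*-cancelˡ-≤ L {{ℕ.>-nonZero xs≢[]}} (ℤₚ.drop‿+≤+ (begin
      + (L ℕ.* (X ℕ.* L))  ≡⟨ trans (ℤₚ.pos-* L (X ℕ.* L)) (cong (_*_ (+ L)) (ℤₚ.pos-* X L)) ⟩
      + L * (+ X * + L)    ≡⟨ rearrange (+ L) (+ X) ⟩
      + X * (+ L * + L)    ≤⟨ count*≤∑ (agreesWith xs x₀) (λ u → walsh xs u * walsh xs u) (+ L * + L) V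
                                   (λ u → square-nonneg (walsh xs u))
                                   (λ u agrees → ℤₚ.≤-reflexive (sym (walsh²-agreesWith xs x₀ u agrees))) ⟩
      ∑[ u ← V ] (walsh xs u * walsh xs u)  ≡⟨ parseval m unique ⟩
      + L * + (2 ^ m)                       ≡⟨ sym (ℤₚ.pos-* L (2 ^ m)) ⟩
      + (L ℕ.* 2 ^ m)                       ∎))
    where
    open ℤₚ.≤-Reasoning
    V = allBoolVecs m
    L = length xs
    X = count (agreesWith xs x₀) V
    rearrange : ∀ a b → a * (b * a) ≡ b * (a * a)
    rearrange = solve-∀

open ℚ using (ℚ; mkℚ; toℚᵘ; 0ℚ; 1ℚ; _/_; _+_; _*_; _≤_)

ι : ℕ → ℚ
ι a = + a / 1

ι≡mkℚ : ∀ a → ι a ≡ mkℚ (+ a) 0 (Coprimality.sym (1-coprimeTo a))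
ι≡mkℚ a = ℚₚ.normalize-coprime (Coprimality.sym (1-coprimeTo a))

ι-+ : ∀ a b → ι (a ℕ.+ b) ≡ ι a + ι b
ι-+ a b = ℚₚ.toℚᵘ-injective (begin
  toℚᵘ (ι (a ℕ.+ b))                    ≈⟨ ℚᵘₚ.≃-reflexive (toℚᵘ-ι (a ℕ.+ b)) ⟩
  ℚᵘ.mkℚᵘ (+ (a ℕ.+ b)) 0               ≈⟨ ℚᵘ.*≡* (cong (ℤ._* + 1) numerator-sum) ⟩
  ℚᵘ.mkℚᵘ (+ a) 0 ℚᵘ.+ ℚᵘ.mkℚᵘ (+ b) 0  ≈⟨ ℚᵘₚ.≃-reflexive (sym (cong₂ ℚᵘ._+_ (toℚᵘ-ι a) (toℚᵘ-ι b))) ⟩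
  toℚᵘ (ι a) ℚᵘ.+ toℚᵘ (ι b)            ≈⟨ ℚᵘₚ.≃-sym (ℚₚ.toℚᵘ-homo-+ (ι a) (ι b)) ⟩
  toℚᵘ (ι a + ι b)                      ∎)
  where
  open ℚᵘₚ.≃-Reasoning
  toℚᵘ-ι : ∀ c → toℚᵘ (ι c) ≡ ℚᵘ.mkℚᵘ (+ c) 0
  toℚᵘ-ι c = cong toℚᵘ (ι≡mkℚ c)
  numerator-sum : + (a ℕ.+ b) ≡ + a ℤ.* + 1 ℤ.+ + b ℤ.* + 1
  numerator-sum = trans (ℤₚ.pos-+ a b) (sym (cong₂ ℤ._+_ (ℤₚ.*-identityʳ (+ a)) (ℤₚ.*-identityʳ (+ b))))

ι-nonneg : ∀ a → 0ℚ ≤ ι a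
ι-nonneg a = ℚₚ.nonNegative⁻¹ (ι a) {{ℚₚ.normalize-nonNeg a 1}}

ι-mono-≤ : ∀ {a b} → a ℕ.≤ b → ι a ≤ ι b
ι-mono-≤ {a} {b} a≤b = begin
  ι a                  ≡⟨ sym (ℚₚ.+-identityʳ (ι a)) ⟩
  ι a + 0ℚ             ≤⟨ ℚₚ.+-monoʳ-≤ (ι a) (ι-nonneg (b ℕ.∸ a)) ⟩
  ι a + ι (b ℕ.∸ a)    ≡⟨ sym (ι-+ a (b ℕ.∸ a)) ⟩
  ι (a ℕ.+ (b ℕ.∸ a))  ≡⟨ cong ι (ℕₚ.m+[n∸m]≡n a≤b) ⟩
  ι b                  ∎
  where open ℚₚ.≤-Reasoning

ι-* : ∀ a b → ι (a ℕ.* b) ≡ ι a * ι b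
ι-* zero    b = sym (ℚₚ.*-zeroˡ (ι b))
ι-* (suc a) b = begin
  ι (b ℕ.+ a ℕ.* b)     ≡⟨ ι-+ b (a ℕ.* b) ⟩
  ι b + ι (a ℕ.* b)     ≡⟨ cong₂ _+_ (sym (ℚₚ.*-identityˡ (ι b))) (ι-* a b) ⟩
  1ℚ * ι b + ι a * ι b  ≡⟨ sym (ℚₚ.*-distribʳ-+ (ι b) 1ℚ (ι a)) ⟩
  (1ℚ + ι a) * ι b      ≡⟨ cong (_* ι b) (sym (ι-+ 1 a)) ⟩
  ι (suc a) * ι b       ∎
  where open ≡-Reasoning

ι-*-reciprocal : ∀ l → ι (suc l) * (+ 1 / suc l) ≡ 1ℚ
ι-*-reciprocal l = trans
  (cong₂ _*_ (ι≡mkℚ (suc l)) (ℚₚ.normalize-coprime (1-coprimeTo (suc l))))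
  (ℚₚ.*-inverseʳ (mkℚ (+ suc l) 0 (Coprimality.sym (1-coprimeTo (suc l)))))

sum : List ℚ → ℚ
sum = List.foldr _+_ 0ℚ

sum-nonneg : ∀ {ys} → All (0ℚ ≤_) ys → 0ℚ ≤ sum ys
sum-nonneg []             = ℚₚ.≤-refl
sum-nonneg (y≥0 ∷ ys≥0)   = ℚₚ.+-mono-≤ y≥0 (sum-nonneg ys≥0)

sum-zero : ∀ {ys} → All (_≡ 0ℚ) ys → sum ys ≡ 0ℚ
sum-zero []               = refl
sum-zero (refl ∷ ys≡0)    = trans (cong (_+_ 0ℚ) (sum-zero ys≡0)) (ℚₚ.+-identityˡ 0ℚ)

sum*≤length : ∀ {ys} c → All (λ y → y * c ≤ 1ℚ) ys → sum ys * c ≤ ι (length ys)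
sum*≤length c []            = ℚₚ.≤-reflexive (ℚₚ.*-zeroˡ c)
sum*≤length {y ∷ ys} c (yc≤1 ∷ ysc≤1) = begin
  (y + sum ys) * c     ≡⟨ ℚₚ.*-distribʳ-+ c y (sum ys) ⟩
  y * c + sum ys * c   ≤⟨ ℚₚ.+-mono-≤ yc≤1 (sum*≤length c ysc≤1) ⟩
  1ℚ + ι (length ys)   ≡⟨ sym (ι-+ 1 (length ys)) ⟩
  ι (length (y ∷ ys))  ∎
  where open ℚₚ.≤-Reasoning

mean-nonneg : ∀ {ys} → All (0ℚ ≤_) ys → 0ℚ ≤ mean ys
mean-nonneg []                     = ℚₚ.≤-refl
mean-nonneg {y ∷ ys} ys≥0 = begin
  0ℚ                ≡⟨ sym (ℚₚ.*-zeroˡ r) ⟩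
  0ℚ * r            ≤⟨ ℚₚ.*-monoʳ-≤-nonNeg r {{ℚₚ.normalize-nonNeg 1 (suc (length ys))}} (sum-nonneg ys≥0) ⟩
  sum (y ∷ ys) * r  ∎
  where
  open ℚₚ.≤-Reasoning
  r = + 1 / suc (length ys)

mean-zero : ∀ {ys} → All (_≡ 0ℚ) ys → mean ys ≡ 0ℚ
mean-zero []               = refl
mean-zero {y ∷ ys} ys≡0 = trans (cong (_* (+ 1 / suc (length ys))) (sum-zero ys≡0)) (ℚₚ.*-zeroˡ (+ 1 / suc (length ys)))

mean*≤1 : ∀ ys c → 0ℚ ≤ c → sum ys * c ≤ ι (length ys) → mean ys * c ≤ 1ℚ
mean*≤1 []       c c≥0 _      = ℚₚ.≤-trans (ℚₚ.≤-reflexive (ℚₚ.*-zeroˡ c)) (ℚₚ.nonNegative⁻¹ 1ℚ)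
mean*≤1 (y ∷ ys) c c≥0 sum*c≤ = begin
  (sum (y ∷ ys) * r) * c   ≡⟨ ℚₚ.*-assoc (sum (y ∷ ys)) r c ⟩
  sum (y ∷ ys) * (r * c)   ≡⟨ cong (_*_ (sum (y ∷ ys))) (ℚₚ.*-comm r c) ⟩
  sum (y ∷ ys) * (c * r)   ≡⟨ sym (ℚₚ.*-assoc (sum (y ∷ ys)) c r) ⟩
  (sum (y ∷ ys) * c) * r   ≤⟨ ℚₚ.*-monoʳ-≤-nonNeg r {{ℚₚ.normalize-nonNeg 1 (suc (length ys))}} sum*c≤ ⟩
  ι (suc (length ys)) * r  ≡⟨ ι-*-reciprocal (length ys) ⟩
  1ℚ                       ∎
  where
  open ℚₚ.≤-Reasoning
  r = + 1 / suc (length ys)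

*-monoʳ-≤-ι : ∀ c {p q} → p ≤ q → p * ι c ≤ q * ι c
*-monoʳ-≤-ι c = ℚₚ.*-monoʳ-≤-nonNeg (ι c) {{ℚₚ.normalize-nonNeg c 1}}

_·ᵥ_ : ∀ {r m} → Vec (Vec Bool m) r → Vec Bool m → Vec Bool r
M ·ᵥ u = Vec.map (λ row → dot row u) M

·ᵥ-++ : ∀ {r r′ m} (M : Vec (Vec Bool m) r) (M′ : Vec (Vec Bool m) r′) u →
        (M Vec.++ M′) ·ᵥ u ≡ (M ·ᵥ u) Vec.++ (M′ ·ᵥ u)
·ᵥ-++ M M′ u = Vecₚ.map-++ (λ row → dot row u) M M′

module _ {k : ℕ} (F : GF2^ k) where
  open GF2^ F
  open IsCommutativeRing isCommRing using (distribʳ; +-identityʳ)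

  φ-injective : ∀ {a b} → φ a ≡ φ b → a ≡ b
  φ-injective {a} {b} φa≡φb = trans (sym (ψφ a)) (trans (cong ψ φa≡φb) (ψφ b))

  ψ-⊕ : ∀ x y → ψ (x ⊕ y) ≡ ψ x +F ψ y
  ψ-⊕ x y = φ-injective (begin
    φ (ψ (x ⊕ y))      ≡⟨ φψ (x ⊕ y) ⟩
    x ⊕ y              ≡⟨ sym (cong₂ _⊕_ (φψ x) (φψ y)) ⟩
    φ (ψ x) ⊕ φ (ψ y)  ≡⟨ sym (φ-additive (ψ x) (ψ y)) ⟩
    φ (ψ x +F ψ y)     ∎)
    where open ≡-Reasoning

  φ-0F : φ 0F ≡ zeros
  φ-0F = begin
    φ 0F          ≡⟨ cong φ (sym (+-identityʳ 0F)) ⟩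
    φ (0F +F 0F)  ≡⟨ φ-additive 0F 0F ⟩
    φ 0F ⊕ φ 0F   ≡⟨ ⊕-self (φ 0F) ⟩
    zeros         ∎
    where open ≡-Reasoning

  mulMatrix : Fin (2 ^ k) → Vec (Vec Bool k) k
  mulMatrix p = Vec.tabulate (λ r → φ (ψ (unit r) *F p))

  dot-mulMatrix : ∀ a p u → dot (φ a) (mulMatrix p ·ᵥ u) ≡ dot (φ (a *F p)) u
  dot-mulMatrix a p u = begin
    dot (φ a) (mulMatrix p ·ᵥ u)                 ≡⟨ cong (dot (φ a)) (sym (Vecₚ.tabulate-∘ (λ row → dot row u) _)) ⟩
    dot (φ a) (Vec.tabulate (λ r → h (unit r)))  ≡⟨ sym (additive⇒dot h h-additive (φ a)) ⟩
    dot (φ (ψ (φ a) *F p)) u                     ≡⟨ cong (λ b → dot (φ (b *F p)) u) (ψφ a) ⟩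
    dot (φ (a *F p)) u                           ∎
    where
    open ≡-Reasoning
    h : Vec Bool k → Bool
    h x = dot (φ (ψ x *F p)) u
    h-additive : IsAdditive h
    h-additive x y = begin
      dot (φ (ψ (x ⊕ y) *F p)) u            ≡⟨ cong (λ b → dot (φ (b *F p)) u) (ψ-⊕ x y) ⟩
      dot (φ ((ψ x +F ψ y) *F p)) u         ≡⟨ cong (λ b → dot (φ b) u) (distribʳ p (ψ x) (ψ y)) ⟩
      dot (φ ((ψ x *F p) +F (ψ y *F p))) u  ≡⟨ cong (λ v → dot v u) (φ-additive (ψ x *F p) (ψ y *F p)) ⟩
      dot (φ (ψ x *F p) ⊕ φ (ψ y *F p)) u   ≡⟨ dot-⊕ˡ (φ (ψ x *F p)) (φ (ψ y *F p)) u ⟩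
      h x xor h y                           ∎

  innerProduct : ∀ {d} → Vec (Fin (2 ^ k)) d → Vec (Fin (2 ^ k)) d → Fin (2 ^ k)
  innerProduct as ps = Vec.foldr _ _+F_ 0F (Vec.zipWith _*F_ as ps)

  dot-concat-mulMatrix : ∀ {d} (as ps : Vec (Fin (2 ^ k)) d) u →
    dot (Vec.concat (Vec.map φ as)) (Vec.concat (Vec.map mulMatrix ps) ·ᵥ u) ≡ dot (φ (innerProduct as ps)) u
  dot-concat-mulMatrix [] [] u = begin
    false         ≡⟨ sym (dot-zerosˡ u) ⟩
    dot zeros u   ≡⟨ cong (λ v → dot v u) (sym φ-0F) ⟩
    dot (φ 0F) u  ∎
    where open ≡-Reasoning
  dot-concat-mulMatrix (a ∷ as) (p ∷ ps) u = begin
    dot (φ a Vec.++ Φ) ((mulMatrix p Vec.++ Ms) ·ᵥ u)         ≡⟨ cong (dot (φ a Vec.++ Φ)) (·ᵥ-++ (mulMatrix p) Ms u) ⟩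
    dot (φ a Vec.++ Φ) ((mulMatrix p ·ᵥ u) Vec.++ (Ms ·ᵥ u))  ≡⟨ dot-++ (φ a) Φ (mulMatrix p ·ᵥ u) (Ms ·ᵥ u) ⟩
    dot (φ a) (mulMatrix p ·ᵥ u) xor dot Φ (Ms ·ᵥ u)          ≡⟨ cong₂ _xor_ (dot-mulMatrix a p u) (dot-concat-mulMatrix as ps u) ⟩
    dot (φ (a *F p)) u xor dot (φ rest) u                     ≡⟨ sym (dot-⊕ˡ (φ (a *F p)) (φ rest) u) ⟩
    dot (φ (a *F p) ⊕ φ rest) u                               ≡⟨ cong (λ v → dot v u) (sym (φ-additive (a *F p) rest)) ⟩
    dot (φ ((a *F p) +F rest)) u                              ∎
    where
    open ≡-Reasoning
    Φ    = Vec.concat (Vec.map φ as)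
    Ms   = Vec.concat (Vec.map mulMatrix ps)
    rest = innerProduct as ps

module _ {k : ℕ} (F : GF2^ k) (d : ℕ) where
  open GF2^ F
  open Procedure F d

  powers : Fin n → Vec (Fin n) d
  powers i = Vec.tabulate (λ l → pow i (Fin.toℕ l))

  Eval≡mulMatrices : ∀ i → Eval i ≡ Vec.concat (Vec.map (mulMatrix F) (powers i))
  Eval≡mulMatrices i = cong (Vec.concat {n = d}) (Vecₚ.tabulate-∘ (mulMatrix F) (λ l → pow i (Fin.toℕ l)))

  evalPoly≡innerProduct : ∀ as i → evalPoly as i ≡ innerProduct F as (powers i)
  evalPoly≡innerProduct as i = cong (Vec.foldr _ _+F_ 0F) (trans (zipWith-map as (Vec.allFin d))
    (cong (Vec.zipWith _*F_ as) (sym (Vecₚ.tabulate-∘ {n = d} (λ l → pow i (Fin.toℕ l)) id))))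
    where
    zipWith-map : ∀ {d′} (as : Vec (Fin n) d′) (ls : Vec (Fin d) d′) →
      Vec.zipWith (λ a l → a *F pow i (Fin.toℕ l)) as ls ≡ Vec.zipWith _*F_ as (Vec.map (λ l → pow i (Fin.toℕ l)) ls)
    zipWith-map []       []       = refl
    zipWith-map (a ∷ as) (l ∷ ls) = cong (_ ∷_) (zipWith-map as ls)

  dot-encode-evalCol : ∀ as i u → dot (encode as) (evalCol i u) ≡ dot (φ (evalPoly as i)) u
  dot-encode-evalCol as i u = begin
    dot (encode as) (Eval i ·ᵥ u)             ≡⟨ cong (λ M → dot (encode as) (M ·ᵥ u)) (Eval≡mulMatrices i) ⟩
    dot (encode as) (Ms ·ᵥ u)                 ≡⟨ dot-concat-mulMatrix F as (powers i) u ⟩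
    dot (φ (innerProduct F as (powers i))) u  ≡⟨ cong (λ a → dot (φ a) u) (sym (evalPoly≡innerProduct as i)) ⟩
    dot (φ (evalPoly as i)) u                 ∎
    where
    open ≡-Reasoning
    Ms = Vec.concat (Vec.map (mulMatrix F) (powers i))

  -- The test under `any` in notInS0, named so that any⁻ and any⁺ can be applied to it.
  feasibleAt : State → Fin n → Fin n → Vec (Fin n) d → Bool
  feasibleAt s i j as = satisfies s (encode as) ∧ ⌊ j Finₚ.≟ evalPoly as i ⌋

  Satisfies : State → Vec Bool (d ℕ.* k) → Set
  Satisfies s v = All (λ cb → dot v (proj₁ cb) ≡ proj₂ cb) s

  satisfies⇒Satisfies : ∀ s v → T (satisfies s v) → Satisfies s v
  satisfies⇒Satisfies []            v _   = []
  satisfies⇒Satisfies ((c , b) ∷ s) v sat =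
    let (v·c≡b , sat-s) = T-∧⁻ {⌊ dot v c Boolₚ.≟ b ⌋} sat
    in toWitness v·c≡b ∷ satisfies⇒Satisfies s v sat-s

  satisfies-++ˡ : ∀ s s′ v → T (satisfies (s ++ s′) v) → T (satisfies s v)
  satisfies-++ˡ []            s′ v _   = _
  satisfies-++ˡ ((c , b) ∷ s) s′ v sat =
    let (v·c≡b , sat-rest) = T-∧⁻ {⌊ dot v c Boolₚ.≟ b ⌋} sat
    in T-∧⁺ v·c≡b (satisfies-++ˡ s s′ v sat-rest)

  Satisfies⇒agreeOnSpan : ∀ s v v′ {w} → Satisfies s v → Satisfies s v′ →
                          w ∈ combos (List.map proj₁ s) → dot v w ≡ dot v′ w
  Satisfies⇒agreeOnSpan [] v v′ _ _ (here refl) = trans (dot-zerosʳ v) (sym (dot-zerosʳ v′))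
  Satisfies⇒agreeOnSpan ((c , b) ∷ s) v v′ (v·c≡b ∷ sat) (v′·c≡b ∷ sat′) w∈span
    with ∈-++⁻ (combos (List.map proj₁ s)) w∈span
  ... | inj₁ w∈span-s = Satisfies⇒agreeOnSpan s v v′ sat sat′ w∈span-s
  ... | inj₂ w∈c⊕span-s with ∈-map⁻ (c ⊕_) w∈c⊕span-s
  ...   | w′ , w′∈span-s , refl = begin
    dot v (c ⊕ w′)          ≡⟨ dot-⊕ʳ v c w′ ⟩
    dot v c xor dot v w′    ≡⟨ cong₂ _xor_ (trans v·c≡b (sym v′·c≡b)) agree-w′ ⟩
    dot v′ c xor dot v′ w′  ≡⟨ sym (dot-⊕ʳ v′ c w′) ⟩
    dot v′ (c ⊕ w′)         ∎
    where
    open ≡-Reasoning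
    agree-w′ = Satisfies⇒agreeOnSpan s v v′ sat sat′ w′∈span-s

  notInS0⇒feasible : ∀ s i j → T (notInS0 s i j) →
                     ∃ λ as → Satisfies s (encode as) × j ≡ evalPoly as i
  notInS0⇒feasible s i j notIn =
    let (as , sat∧eq) = Any.satisfied (any⁻ (feasibleAt s i j) (allVecs elems d) notIn)
        (sat , eq)    = T-∧⁻ {satisfies s (encode as)} sat∧eq
    in as , satisfies⇒Satisfies s (encode as) sat , toWitness eq

  notInS0-++ : ∀ s s′ i j → T (notInS0 (s ++ s′) i j) → T (notInS0 s i j)
  notInS0-++ s s′ i j =
    any⁺ (feasibleAt s i j) ∘ Any.map (λ {as} → weaken as) ∘ any⁻ (feasibleAt (s ++ s′) i j) (allVecs elems d)
    where
    weaken : ∀ as → T (feasibleAt (s ++ s′) i j as) → T (feasibleAt s i j as)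
    weaken as sat∧eq =
      let (sat , eq) = T-∧⁻ {satisfies (s ++ s′) (encode as)} sat∧eq
      in T-∧⁺ (satisfies-++ˡ s s′ (encode as) sat) eq

  feasible-values-agree : ∀ s i u as as′ → Satisfies s (encode as) → Satisfies s (encode as′) →
    evalCol i u ∈ combos (List.map proj₁ s) → dot (φ (evalPoly as i)) u ≡ dot (φ (evalPoly as′ i)) u
  feasible-values-agree s i u as as′ sat sat′ col∈span = begin
    dot (φ (evalPoly as i)) u       ≡⟨ sym (dot-encode-evalCol as i u) ⟩
    dot (encode as) (evalCol i u)   ≡⟨ Satisfies⇒agreeOnSpan s (encode as) (encode as′) sat sat′ col∈span ⟩
    dot (encode as′) (evalCol i u)  ≡⟨ dot-encode-evalCol as′ i u ⟩
    dot (φ (evalPoly as′ i)) u      ∎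
    where open ≡-Reasoning

  inSpanOf : Fin n → State → Vec Bool k → Bool
  inSpanOf i s u = inSpan (evalCol i u) (List.map proj₁ s)

  extend : Fin n → State → Vec Bool k → Bool → State
  extend i s u b = s ++ (evalCol i u , b) ∷ []

  module Row (i₀ : Fin n) (S : List (Fin n)) where

    rowAlive : State → Bool
    rowAlive s = all (notInS0 s i₀) S

    rowAlive-++ : ∀ s s′ → T (rowAlive (s ++ s′)) → T (rowAlive s)
    rowAlive-++ s s′ =
      all⁻ (notInS0 s i₀) ∘ All.map (λ {j} → notInS0-++ s s′ i₀ j) ∘ all⁺ (notInS0 (s ++ s′) i₀) S

    rowAlive⇒feasible : ∀ s {j} → T (rowAlive s) → j ∈ S →
                        ∃ λ as → Satisfies s (encode as) × j ≡ evalPoly as i₀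
    rowAlive⇒feasible s {j} alive j∈S =
      notInS0⇒feasible s i₀ j (All.lookup (all⁺ (notInS0 s i₀) S alive) j∈S)

    agrees : Fin n → Vec Bool k → Bool
    agrees j₀ = agreesWith (List.map φ S) (φ j₀)

    agrees-intro : ∀ j₀ u → (∀ {j} → j ∈ S → dot (φ j) u ≡ dot (φ j₀) u) → T (agrees j₀ u)
    agrees-intro j₀ u agree = all⁻ _ (map⁺ (All.tabulate (fromWitness ∘ agree)))

    inSpan⇒agrees : ∀ s u {j₀} → j₀ ∈ S → T (rowAlive s) →
                    T (inSpanOf i₀ s u) → T (agrees j₀ u)
    inSpan⇒agrees s u {j₀} j₀∈S alive col-inSpan = agrees-intro j₀ u agree
      where
      agree : ∀ {j} → j ∈ S → dot (φ j) u ≡ dot (φ j₀) u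
      agree j∈S with rowAlive⇒feasible s alive j∈S | rowAlive⇒feasible s alive j₀∈S
      ... | as , sat , refl | as₀ , sat₀ , refl =
        feasible-values-agree s i₀ u as as₀ sat sat₀ (inSpan⇒∈combos (evalCol i₀ u) (List.map proj₁ s) col-inSpan)

    alive-extend⇒dot≡ : ∀ s u b {j} → T (rowAlive (extend i₀ s u b)) → j ∈ S → dot (φ j) u ≡ b
    alive-extend⇒dot≡ s u b alive j∈S with rowAlive⇒feasible (extend i₀ s u b) alive j∈S
    ... | as , sat , refl with ++⁻ʳ s sat
    ...   | col·as≡b ∷ [] = trans (sym (dot-encode-evalCol as i₀ u)) col·as≡b

    alive-extend⇒agrees : ∀ s u b {j₀} → j₀ ∈ S → T (rowAlive (extend i₀ s u b)) → T (agrees j₀ u)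
    alive-extend⇒agrees s u b {j₀} j₀∈S alive = agrees-intro j₀ u λ j∈S →
      trans (alive-extend⇒dot≡ s u b alive j∈S) (sym (alive-extend⇒dot≡ s u b alive j₀∈S))

    alive-extend-both⇒⊥ : ∀ s u {j₀} → j₀ ∈ S →
                          T (rowAlive (extend i₀ s u false)) → T (rowAlive (extend i₀ s u true)) → ⊥
    alive-extend-both⇒⊥ s u j₀∈S alive-false alive-true
      with () ← trans (sym (alive-extend⇒dot≡ s u false alive-false j₀∈S))
                      (alive-extend⇒dot≡ s u true alive-true j₀∈S)

  candidates : Fin n → State → List (Vec Bool k)
  candidates i s = List.filter (T? ∘ not ∘ inSpanOf i s) (allBoolVecs k)

  branches : Fin n → State → (State → ℚ) → List (Vec Bool k) → List ℚ
  branches i s g = List.concatMap λ u → List.map (g ∘ extend i s u) (false ∷ true ∷ [])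

  averageOver : Fin n → State → (State → ℚ) → List (Vec Bool k) → ℚ
  averageOver i s g []         = g s
  averageOver i s g us@(_ ∷ _) = mean (branches i s g us)

  step≡averageOver : ∀ i s g → step i s g ≡ averageOver i s g (candidates i s)
  step≡averageOver i s g with candidates i s
  ... | []    = refl
  ... | _ ∷ _ = refl

  All-branches : ∀ {P : ℚ → Set} i s g → (∀ u b → P (g (extend i s u b))) → ∀ us → All P (branches i s g us)
  All-branches i s g P-g []       = []
  All-branches i s g P-g (u ∷ us) = P-g u false ∷ P-g u true ∷ All-branches i s g P-g us

  length-branches : ∀ i s g us → length (branches i s g us) ≡ length us ℕ.+ length us
  length-branches i s g []       = refl
  length-branches i s g (u ∷ us) =
    cong suc (trans (cong suc (length-branches i s g us)) (sym (ℕₚ.+-suc (length us) (length us))))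

  PrefixClosed : (State → Bool) → Set
  PrefixClosed alive = ∀ s s′ → T (alive (s ++ s′)) → T (alive s)

  record Bounded (alive : State → Bool) (K : ℕ) (g : State → ℚ) : Set where
    field
      nonneg   : ∀ s → 0ℚ ≤ g s
      scaled≤1 : ∀ s → g s * ι K ≤ 1ℚ
      vanishes : ∀ s → ¬ T (alive s) → g s ≡ 0ℚ

  module _ {alive : State → Bool} {K : ℕ} {g : State → ℚ} (G : Bounded alive K g) (i : Fin n) where
    open Bounded G

    step-nonneg : ∀ s → 0ℚ ≤ step i s g
    step-nonneg s rewrite step≡averageOver i s g with candidates i s
    ... | []         = nonneg s
    ... | us@(_ ∷ _) = mean-nonneg (All-branches i s g (λ _ _ → nonneg _) us)

    step-vanishes : PrefixClosed alive → ∀ s → ¬ T (alive s) → step i s g ≡ 0ℚ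
    step-vanishes closed s dead rewrite step≡averageOver i s g with candidates i s
    ... | []         = vanishes s dead
    ... | us@(_ ∷ _) = mean-zero (All-branches i s g (λ _ _ → vanishes _ (dead ∘ closed s _)) us)

    step-scaled≤1 : ∀ s → step i s g * ι K ≤ 1ℚ
    step-scaled≤1 s rewrite step≡averageOver i s g with candidates i s
    ... | []         = scaled≤1 s
    ... | us@(_ ∷ _) = mean*≤1 (branches i s g us) (ι K) (ι-nonneg K)
                         (sum*≤length (ι K) (All-branches i s g (λ _ _ → scaled≤1 _) us))

  step-Bounded : ∀ {alive K g} → PrefixClosed alive → Bounded alive K g → ∀ i → Bounded alive K (λ s → step i s g)
  step-Bounded closed G i = record
    { nonneg   = step-nonneg G i
    ; scaled≤1 = step-scaled≤1 G i
    ; vanishes = step-vanishes G i closed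
    }

  runSteps-Bounded : ∀ {alive K g} → PrefixClosed alive → ∀ xs {ys} →
    Bounded alive K (λ s → runSteps ys s g) → Bounded alive K (λ s → runSteps (xs ++ ys) s g)
  runSteps-Bounded closed []       G = G
  runSteps-Bounded closed (i ∷ xs) G = step-Bounded closed (runSteps-Bounded closed xs G) i

  module RowStep (i₀ : Fin n) (S : List (Fin n)) {j₀ : Fin n} (j₀∈S : j₀ ∈ S)
                 (unique : Unique (List.map φ S)) (t : ℕ) .{{_ : ℕ.NonZero t}} (t<|S| : t ℕ.< length S) where
    open Row i₀ S

    rowAlive-closed : PrefixClosed rowAlive
    rowAlive-closed = rowAlive-++

    module _ (s : State) (alive : T (rowAlive s)) where
      private
        C = length (candidates i₀ s)
        N = count (inSpanOf i₀ s) (allBoolVecs k)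
        X = count (agrees j₀) (allBoolVecs k)

        C+N≡2^k : C ℕ.+ N ≡ 2 ^ k
        C+N≡2^k = trans (length-filter-not+count (inSpanOf i₀ s) (allBoolVecs k)) (length-allBoolVecs k)

        N≤X : N ℕ.≤ X
        N≤X = count-mono _ _ (λ u → inSpan⇒agrees s u j₀∈S alive) (allBoolVecs k)

        X*|S|≤2^k : X ℕ.* length S ℕ.≤ 2 ^ k
        X*|S|≤2^k = subst (λ L → X ℕ.* L ℕ.≤ 2 ^ k) (Listₚ.length-map φ S)
          (count-agreesWith*length≤2^m k (φ j₀) unique φS-nonempty)
          where
          φS-nonempty : 0 ℕ.< length (List.map φ S)
          φS-nonempty = subst (0 ℕ.<_) (sym (Listₚ.length-map φ S)) (ℕₚ.≤-<-trans ℕ.z≤n t<|S|)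

        X*t≤C : X ℕ.* t ℕ.≤ C
        X*t≤C = ℕₚ.+-cancelˡ-≤ X (X ℕ.* t) C (begin
          X ℕ.+ X ℕ.* t   ≡⟨ sym (ℕₚ.*-suc X t) ⟩
          X ℕ.* suc t     ≤⟨ ℕₚ.*-monoʳ-≤ X t<|S| ⟩
          X ℕ.* length S  ≤⟨ X*|S|≤2^k ⟩
          2 ^ k           ≡⟨ sym C+N≡2^k ⟩
          C ℕ.+ N         ≤⟨ ℕₚ.+-monoʳ-≤ C N≤X ⟩
          C ℕ.+ X         ≡⟨ ℕₚ.+-comm C X ⟩
          X ℕ.+ C         ∎)
          where open ℕₚ.≤-Reasoning

      candidates-count : count (agrees j₀) (candidates i₀ s) ℕ.* t ℕ.≤ length (candidates i₀ s)
      candidates-count =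
        ℕₚ.≤-trans (ℕₚ.*-monoˡ-≤ t (count-filter (agrees j₀) (not ∘ inSpanOf i₀ s) (allBoolVecs k))) X*t≤C

      -- Without a fresh candidate the step would leave the state, and so the bound, unchanged.
      candidates-nonempty : 0 ℕ.< length (candidates i₀ s)
      candidates-nonempty = double-positive C (begin-strict
        0              <⟨ ℕₚ.m^n>0 2 k ⟩
        2 ^ k          ≡⟨ sym C+N≡2^k ⟩
        C ℕ.+ N        ≤⟨ ℕₚ.+-monoʳ-≤ C N≤X ⟩
        C ℕ.+ X        ≤⟨ ℕₚ.+-monoʳ-≤ C (ℕₚ.m≤m*n X t) ⟩
        C ℕ.+ X ℕ.* t  ≤⟨ ℕₚ.+-monoʳ-≤ C X*t≤C ⟩
        C ℕ.+ C        ∎)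
        where
        open ℕₚ.≤-Reasoning
        double-positive : ∀ c → 0 ℕ.< c ℕ.+ c → 0 ℕ.< c
        double-positive (suc c) _ = ℕ.s≤s ℕ.z≤n

    module _ {K : ℕ} {h : State → ℚ} (H : Bounded rowAlive K h) where
      open Bounded H

      private
        ≡0⇒*≡0 : ∀ {x} c → x ≡ 0ℚ → x * c ≡ 0ℚ
        ≡0⇒*≡0 c refl = ℚₚ.*-zeroˡ c

      dead⇒scaled≡0 : ∀ s → ¬ T (rowAlive s) → h s * ι K ≡ 0ℚ
      dead⇒scaled≡0 s dead = ≡0⇒*≡0 (ι K) (vanishes s dead)

      branchPair : State → Vec Bool k → ℚ
      branchPair s u = h (extend i₀ s u false) * ι K + h (extend i₀ s u true) * ι K

      branchPair≤1 : ∀ s u → branchPair s u ≤ 1ℚ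
      branchPair≤1 s u = by-aliveness (T? (rowAlive s₀)) (T? (rowAlive s₁))
        where
        open ℚₚ.≤-Reasoning
        s₀ = extend i₀ s u false
        s₁ = extend i₀ s u true
        by-aliveness : Dec (T (rowAlive s₀)) → Dec (T (rowAlive s₁)) → branchPair s u ≤ 1ℚ
        by-aliveness (yes alive₀) (yes alive₁) = ⊥-elim (alive-extend-both⇒⊥ s u j₀∈S alive₀ alive₁)
        by-aliveness _            (no dead₁)   = begin
          h s₀ * ι K + h s₁ * ι K  ≡⟨ cong (_+_ (h s₀ * ι K)) (dead⇒scaled≡0 s₁ dead₁) ⟩
          h s₀ * ι K + 0ℚ          ≡⟨ ℚₚ.+-identityʳ (h s₀ * ι K) ⟩
          h s₀ * ι K               ≤⟨ scaled≤1 s₀ ⟩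
          1ℚ                       ∎
        by-aliveness (no dead₀)   (yes _)      = begin
          h s₀ * ι K + h s₁ * ι K  ≡⟨ cong (_+ h s₁ * ι K) (dead⇒scaled≡0 s₀ dead₀) ⟩
          0ℚ + h s₁ * ι K          ≡⟨ ℚₚ.+-identityˡ (h s₁ * ι K) ⟩
          h s₁ * ι K               ≤⟨ scaled≤1 s₁ ⟩
          1ℚ                       ∎

      branchPair≡0 : ∀ s u → ¬ T (agrees j₀ u) → branchPair s u ≡ 0ℚ
      branchPair≡0 s u disagree = cong₂ _+_ (dead-branch false) (dead-branch true)
        where
        dead-branch : ∀ b → h (extend i₀ s u b) * ι K ≡ 0ℚ
        dead-branch b = dead⇒scaled≡0 (extend i₀ s u b) (disagree ∘ alive-extend⇒agrees s u b j₀∈S)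

      sum-branches*≤count : ∀ s us → sum (branches i₀ s h us) * ι K ≤ ι (count (agrees j₀) us)
      sum-branches*≤count s []       = ℚₚ.≤-reflexive (ℚₚ.*-zeroˡ (ι K))
      sum-branches*≤count s (u ∷ us) = begin
        (a + (b + R)) * ι K             ≡⟨ ℚₚ.*-distribʳ-+ (ι K) a (b + R) ⟩
        a * ι K + (b + R) * ι K         ≡⟨ cong (_+_ (a * ι K)) (ℚₚ.*-distribʳ-+ (ι K) b R) ⟩
        a * ι K + (b * ι K + R * ι K)   ≡⟨ sym (ℚₚ.+-assoc (a * ι K) (b * ι K) (R * ι K)) ⟩
        branchPair s u + R * ι K        ≤⟨ by-agreement (T? (agrees j₀ u)) ⟩
        ι (count (agrees j₀) (u ∷ us))  ∎
        where
        open ℚₚ.≤-Reasoning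
        a = h (extend i₀ s u false)
        b = h (extend i₀ s u true)
        R = sum (branches i₀ s h us)
        by-agreement : Dec (T (agrees j₀ u)) → branchPair s u + R * ι K ≤ ι (count (agrees j₀) (u ∷ us))
        by-agreement (yes agree) = begin
          branchPair s u + R * ι K        ≤⟨ ℚₚ.+-mono-≤ (branchPair≤1 s u) (sum-branches*≤count s us) ⟩
          1ℚ + ι (count (agrees j₀) us)   ≡⟨ sym (ι-+ 1 (count (agrees j₀) us)) ⟩
          ι (suc (count (agrees j₀) us))  ≡⟨ cong ι (sym (count-accept (agrees j₀) us agree)) ⟩
          ι (count (agrees j₀) (u ∷ us))  ∎
        by-agreement (no disagree) = begin
          branchPair s u + R * ι K        ≡⟨ cong (_+ R * ι K) (branchPair≡0 s u disagree) ⟩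
          0ℚ + R * ι K                    ≡⟨ ℚₚ.+-identityˡ (R * ι K) ⟩
          R * ι K                         ≤⟨ sum-branches*≤count s us ⟩
          ι (count (agrees j₀) us)        ≡⟨ cong ι (sym (count-reject (agrees j₀) us disagree)) ⟩
          ι (count (agrees j₀) (u ∷ us))  ∎

      averageOver-scaled≤1 : ∀ s → T (rowAlive s) → ∀ us → us ≡ candidates i₀ s →
                             averageOver i₀ s h us * ι (K ℕ.* t) ≤ 1ℚ
      averageOver-scaled≤1 s alive [] []≡cands =
        ⊥-elim (ℕₚ.n≮0 (subst (λ us → 0 ℕ.< length us) (sym []≡cands) (candidates-nonempty s alive)))
      averageOver-scaled≤1 s alive us@(_ ∷ _) us≡cands =
        mean*≤1 bs (ι (K ℕ.* t)) (ι-nonneg (K ℕ.* t)) (begin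
        sum bs * ι (K ℕ.* t)            ≡⟨ cong (_*_ (sum bs)) (ι-* K t) ⟩
        sum bs * (ι K * ι t)            ≡⟨ sym (ℚₚ.*-assoc (sum bs) (ι K) (ι t)) ⟩
        (sum bs * ι K) * ι t            ≤⟨ *-monoʳ-≤-ι t (sum-branches*≤count s us) ⟩
        ι (count (agrees j₀) us) * ι t  ≡⟨ sym (ι-* (count (agrees j₀) us) t) ⟩
        ι (count (agrees j₀) us ℕ.* t)  ≤⟨ ι-mono-≤ (ℕₚ.≤-trans count*t≤|us| (ℕₚ.m≤m+n _ _)) ⟩
        ι (length us ℕ.+ length us)     ≡⟨ cong ι (sym (length-branches i₀ s h us)) ⟩
        ι (length bs)                   ∎)
        where
        open ℚₚ.≤-Reasoning
        bs = branches i₀ s h us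
        count*t≤|us| : count (agrees j₀) us ℕ.* t ℕ.≤ length us
        count*t≤|us| =
          subst (λ vs → count (agrees j₀) vs ℕ.* t ℕ.≤ length vs) (sym us≡cands) (candidates-count s alive)

      rowStep-scaled≤1 : ∀ s → step i₀ s h * ι (K ℕ.* t) ≤ 1ℚ
      rowStep-scaled≤1 s with T? (rowAlive s)
      ... | yes alive = subst (λ x → x * ι (K ℕ.* t) ≤ 1ℚ) (sym (step≡averageOver i₀ s h))
                              (averageOver-scaled≤1 s alive (candidates i₀ s) refl)
      ... | no dead   = begin
        step i₀ s h * ι (K ℕ.* t)  ≡⟨ ≡0⇒*≡0 (ι (K ℕ.* t)) (step-vanishes H i₀ rowAlive-closed s dead) ⟩
        0ℚ                         ≤⟨ ℚₚ.nonNegative⁻¹ 1ℚ ⟩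
        1ℚ                         ∎
        where open ℚₚ.≤-Reasoning

      rowStep-Bounded : Bounded rowAlive (K ℕ.* t) (λ s → step i₀ s h)
      rowStep-Bounded = record
        { nonneg   = step-nonneg H i₀
        ; scaled≤1 = rowStep-scaled≤1
        ; vanishes = step-vanishes H i₀ rowAlive-closed
        }

    rowSteps-Bounded : ∀ {K g} m {ys} → Bounded rowAlive K (λ s → runSteps ys s g) →
                       Bounded rowAlive (K ℕ.* t ^ m) (λ s → runSteps (List.replicate m i₀ ++ ys) s g)
    rowSteps-Bounded {K} {g} zero    {ys} G =
      subst (λ K′ → Bounded rowAlive K′ (λ s → runSteps ys s g)) (sym (ℕₚ.*-identityʳ K)) G
    rowSteps-Bounded {K} {g} (suc m) {ys} G =
      subst (λ K′ → Bounded rowAlive K′ (λ s → runSteps (List.replicate (suc m) i₀ ++ ys) s g))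
            (trans (ℕₚ.*-assoc K (t ^ m) t) (cong (K ℕ.*_) (ℕₚ.*-comm (t ^ m) t)))
            (rowStep-Bounded (rowSteps-Bounded {g = g} m {ys} G))

    schedule-Bounded : ∀ m xs {K g} → i₀ ∈ xs → Bounded rowAlive K g →
                       Bounded rowAlive (K ℕ.* t ^ m) (λ s → runSteps (List.concatMap (List.replicate m) xs) s g)
    schedule-Bounded m (_ ∷ xs) {K} {g} (here refl) G =
      rowSteps-Bounded {K} {g} m {rest}
        (subst (λ zs → Bounded rowAlive K (λ s → runSteps zs s g)) (Listₚ.++-identityʳ rest)
               (runSteps-Bounded {rowAlive} {K} {g} rowAlive-closed rest {[]} G))
      where rest = List.concatMap (List.replicate m) xs
    schedule-Bounded m (x ∷ xs) {K} {g} (there i₀∈xs) G =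
      runSteps-Bounded {rowAlive} {K ℕ.* t ^ m} {g} rowAlive-closed (List.replicate m x)
        {List.concatMap (List.replicate m) xs} (schedule-Bounded m xs i₀∈xs G)

module _ {k : ℕ} (F : GF2^ k) (d : ℕ) (e : Fin (Procedure.n F d) → Fin (Procedure.n F d) → ℕ) where
  open GF2^ F
  open Procedure F d

  support : Fin n → List (Fin n)
  support i = List.filter (λ j → 0 ℕ.<? e i j) elems

  supportAlive : Fin n → State → Bool
  supportAlive i = Row.rowAlive F d i (support i)

  survives⇒supportAlive : ∀ i s → T (survives e s) → T (supportAlive i s)
  survives⇒supportAlive i s surv = all⁻ (notInS0 s i) (All.tabulate notIn)
    where
    row-i = All.lookup (all⁺ _ elems surv) (∈-allFin i)
    notIn : ∀ {j} → j ∈ support i → T (notInS0 s i j)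
    notIn {j} j∈S with ∈-filter⁻ (λ j → 0 ℕ.<? e i j) {xs = elems} j∈S
    ... | j∈elems , 0<eij with e i j ℕ.≟ 0 | All.lookup (all⁺ _ elems row-i) j∈elems
    ...   | yes eij≡0 | _       = ⊥-elim (ℕₚ.<-irrefl (sym eij≡0) 0<eij)
    ...   | no _      | notIn′  = notIn′

  survivalIndicator-Bounded : ∀ i → Bounded F d (supportAlive i) 1 (λ s → if survives e s then 1ℚ else 0ℚ)
  survivalIndicator-Bounded i = record { nonneg = nonneg ; scaled≤1 = scaled≤1 ; vanishes = vanishes }
    where
    nonneg : ∀ s → 0ℚ ≤ (if survives e s then 1ℚ else 0ℚ)
    nonneg s with survives e s
    ... | true  = ℚₚ.nonNegative⁻¹ 1ℚ
    ... | false = ℚₚ.≤-refl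
    scaled≤1 : ∀ s → (if survives e s then 1ℚ else 0ℚ) * ι 1 ≤ 1ℚ
    scaled≤1 s with survives e s
    ... | true  = ℚₚ.≤-refl
    ... | false = ℚₚ.nonNegative⁻¹ 1ℚ
    vanishes : ∀ s → ¬ T (supportAlive i s) → (if survives e s then 1ℚ else 0ℚ) ≡ 0ℚ
    vanishes s dead with survives e s in surv
    ... | true  = ⊥-elim (dead (survives⇒supportAlive i s (subst T (sym surv) _)))
    ... | false = refl

lemma5p9 : (k : ℕ) (F : GF2^ k) (d m t : ℕ) → t ≥ 1 →
    (e : Fin (Procedure.n F d) → Fin (Procedure.n F d) → ℕ) →
    ∃ (λ i → t < Procedure.rowSupport F d e i) →
    Procedure.survivalProb F d m e * (+ (t ^ m) / 1) ≤ 1ℚ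
lemma5p9 k F d m t t≥1 e (i₀ , t<|S|) =
  subst (λ K → survivalProb m e * ι K ≤ 1ℚ) (ℕₚ.*-identityˡ (t ^ m))
        (Bounded.scaled≤1 (schedule-Bounded m elems (∈-allFin i₀) (survivalIndicator-Bounded F d e i₀)) [])
  where
  open GF2^ F
  open Procedure F d
  S = support F d e i₀
  j₀∈S = proj₂ (nonempty⇒∈ (ℕₚ.≤-<-trans ℕ.z≤n t<|S|))
  unique = Uniqueₚ.map⁺ (φ-injective F) (Uniqueₚ.filter⁺ (λ j → 0 ℕ.<? e i₀ j) (Uniqueₚ.allFin⁺ n))
  open RowStep F d i₀ S j₀∈S unique t {{ℕ.>-nonZero t≥1}} t<|S|
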